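{- Let $L$ be a countable language, $M$ an $L$-structure, $\mathcal F$ a sharp back-and-forth system on $M$ with $E_n=\mathcal F\cap M^{2n}$, and $\mathbb B=(M,\mathcal F)^\flat$. Then for every $n$, every $L_{\infty,\omega}$-formula $\varphi(x_0,\dots,x_{n-1})$ and every $\bar a\in M^n$: $M\models\varphi(\bar a)$ if and only if $\mathbb B\models\varphi^\flat(\bar a/E_n)$.
   Context: A back-and-forth system on $M$ is a nonempty set $\mathcal F$ of pairs $(\bar a,\bar b)$ of finite tuples of equal length such that $\bar a\mapsto\bar b$ preserves atomic formulas and for each $(\bar a,\bar b)\in\mathcal F$ and $c\in M$ some $d$ has $(\bar ac,\bar bd)\in\mathcal F$, and for each $d$ some $c$ has $(\bar ac,\bar bd)\in\mathcal F$. $\mathcal F$ is sharp if it is closed under $(\bar a,\bar b)\mapsto(\bar a{\restriction}f,\bar b{\restriction}f)$ for injections $f:k\to n$ (where $\bar a{\restriction}f=(a_{f(0)},\dots,a_{f(k-1)})$) and each $\mathcal F\cap M^{2k}$ is an equivalence relation on $M^k$. $L^\flat$ has unary predicates $U_n$, unary predicates $\alpha_n^\flat$ for each quantifier-free $L$-formula $\alpha(x_0,\dots,x_{n-1})$ with free variables among $x_0,\dots,x_{n-1}$, and unary functions $P^f_{k,n}$ for injections $f:k\to n$. The flattening $(M,\mathcal F)^\flat$ has universe $\bigsqcup_n M^n/E_n$, $U_n=M^n/E_n$, $\alpha_n^\flat=\{\bar a/E_n:M\models\alpha(\bar a)\}$, $P^f_{k,n}(\bar a/E_n)=(\bar a{\restriction}f)/E_k$.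 For $\varphi(x_0,\dots,x_{n-1})\in L_{\infty,\omega}$, $\varphi^\flat(z)$ is defined recursively: $\alpha^\flat=\alpha_n^\flat$ for quantifier-free $\alpha$; $(\bigwedge_i\varphi_i)^\flat=\bigwedge_i\varphi_i^\flat$; $(\neg\varphi)^\flat=\neg\varphi^\flat$; $(\exists y\theta(x_0,\dots,x_{n-1},y))^\flat=\exists w(U_{n+1}(w)\wedge\theta^\flat(w)\wedge P^{id}_{n,n+1}(w)=z)$. -}

module Defs where

open import Data.Nat using (ℕ; zero; suc; _≟_)
open import Data.Fin using (Fin; zero; suc; fromℕ; inject₁)
open import Data.Vec using (Vec; []; _∷_; lookup; tabulate; _∷ʳ_)
open import Data.Product using (Σ; _×_; _,_)
open import Data.Sum using (_⊎_; inj₁; inj₂)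
open import Data.Empty using (⊥)
open import Level using (Level)
open import Relation.Nullary using (¬_; yes; no)
open import Relation.Binary.PropositionalEquality using (_≡_; refl)
open import Relation.Binary.Structures using (IsEquivalence)
open import Function.Bundles using (_↣_; Injection; _⇔_)
open import Function.Definitions using (Injective)

Countable : Set → Set
Countable A = Σ (A → ℕ) (λ c → Injective _≡_ _≡_ c)

record Language : Set₁ where
  field
    Func : ℕ → Set
    Rel  : ℕ → Set

IsCountableLanguage : Language → Set
IsCountableLanguage L =
  Countable (Σ ℕ (Language.Func L)) × Countable (Σ ℕ (Language.Rel L))

module _ (L : Language) where
  open Language L

  data Term (n : ℕ) : Set where
    var : Fin n → Term n
    app : ∀ {k} → Func k → (Fin k → Term n) → Term n

  data Atomic (n : ℕ) : Set where
    eq  : Term n → Term n → Atomic n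
    rel : ∀ {k} → Rel k → (Fin k → Term n) → Atomic n

  data QF (n : ℕ) : Set where
    atom : Atomic n → QF n
    neg  : QF n → QF n
    and  : QF n → QF n → QF n

  -- L_{∞,ω}-formulas with free variables among x₀ … x_{n-1}.
  -- ⋀ is a conjunction over an arbitrary index set; ∃ binds the new
  -- last variable x_n.
  data Formula (n : ℕ) : Set₁ where
    qf : QF n → Formula n
    ⋀  : (I : Set) → (I → Formula n) → Formula n
    ¬' : Formula n → Formula n
    ∃' : Formula (suc n) → Formula n

record Structure (L : Language) : Set₁ where
  open Language L
  field
    Carrier : Set
    funᴹ    : ∀ {k} → Func k → (Fin k → Carrier) → Carrier
    relᴹ    : ∀ {k} → Rel k → (Fin k → Carrier) → Set

-- A structure presented as a quotient: carrier of representatives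
-- together with the relation interpreting the equality symbol.
record QStructure (L : Language) : Set₁ where
  field
    struct : Structure L
  open Structure struct public
  field
    _≈_ : Carrier → Carrier → Set

std : {L : Language} → Structure L → QStructure L
std M = record { struct = M ; _≈_ = _≡_ }

module _ {L : Language} (A : QStructure L) where
  open QStructure A

  evalT : ∀ {n} → Term L n → Vec Carrier n → Carrier
  evalT (var i)    ρ = lookup ρ i
  evalT (app f ts) ρ = funᴹ f (λ i → evalT (ts i) ρ)

  SatAt : ∀ {n} → Atomic L n → Vec Carrier n → Set
  SatAt (eq t s)   ρ = evalT t ρ ≈ evalT s ρ
  SatAt (rel r ts) ρ = relᴹ r (λ i → evalT (ts i) ρ)

  SatQF : ∀ {n} → QF L n → Vec Carrier n → Set
  SatQF (atom α)  ρ = SatAt α ρ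
  SatQF (neg α)   ρ = ¬ SatQF α ρ
  SatQF (and α β) ρ = SatQF α ρ × SatQF β ρ

  Sat : ∀ {n} → Formula L n → Vec Carrier n → Set
  Sat (qf α)   ρ = SatQF α ρ
  Sat (⋀ I φ)  ρ = (i : I) → Sat (φ i) ρ
  Sat (¬' φ)   ρ = ¬ Sat φ ρ
  Sat (∃' φ)   ρ = Σ Carrier (λ c → Sat φ (ρ ∷ʳ c))

_↾_ : ∀ {A : Set} {k n} → Vec A n → Fin k ↣ Fin n → Vec A k
a ↾ f = tabulate (λ i → lookup a (Injection.to f i))

System : Set → Set₁
System M = (n : ℕ) → Vec M n → Vec M n → Set

record IsBackAndForth {L : Language} (M : Structure L)
                      (F : System (Structure.Carrier M)) : Set₁ where
  field
    nonempty : Σ ℕ (λ n → Σ (Vec (Structure.Carrier M) n)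
                 (λ a → Σ (Vec (Structure.Carrier M) n) (λ b → F n a b)))
    preserves : ∀ n a b → F n a b → (α : Atomic L n) →
                SatAt (std M) α a ⇔ SatAt (std M) α b
    forth : ∀ n a b → F n a b → (c : Structure.Carrier M) →
            Σ (Structure.Carrier M) (λ d → F (suc n) (a ∷ʳ c) (b ∷ʳ d))
    back  : ∀ n a b → F n a b → (d : Structure.Carrier M) →
            Σ (Structure.Carrier M) (λ c → F (suc n) (a ∷ʳ c) (b ∷ʳ d))

record IsSharp {L : Language} (M : Structure L)
               (F : System (Structure.Carrier M)) : Set₁ where
  field
    isBackAndForth : IsBackAndForth M F
    restrict : ∀ k n (f : Fin k ↣ Fin n) a b → F n a b → F k (a ↾ f) (b ↾ f)
    isEquivalence : ∀ k → IsEquivalence (F k)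

module _ (L : Language) where

  data Func♭ : ℕ → Set where
    P : (k n : ℕ) → Fin k ↣ Fin n → Func♭ 1

  data Rel♭ : ℕ → Set where
    U  : ℕ → Rel♭ 1
    α♭ : (n : ℕ) → QF L n → Rel♭ 1

  L♭ : Language
  L♭ = record { Func = Func♭ ; Rel = Rel♭ }

-- The flattening (M, F)^♭, presented as the quotient of ⨆_n M^n
-- by the relation (n, ā) ≈ (n, b̄) ⟺ (ā, b̄) ∈ F.

module Flat {L : Language} (M : Structure L)
            (F : System (Structure.Carrier M)) where
  open Structure M renaming (Carrier to |M|)

  Elt : Set
  Elt = Σ ℕ (Vec |M|)

  data _≈♭_ : Elt → Elt → Set where
    cls : ∀ {n a b} → F n a b → (n , a) ≈♭ (n , b)

  data InU (n : ℕ) : Elt → Set where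
    inU : ∀ {a} → InU n (n , a)

  data HoldsQF {n : ℕ} (α : QF L n) : Elt → Set where
    holds : ∀ {a} → SatQF (std M) α a → HoldsQF α (n , a)

  -- P^f_{k,n}(ā/E_n) = (ā↾f)/E_k on U_n; on elements outside U_n
  -- (where the paper leaves it unspecified) we take the identity.
  projF : ∀ {k n} → Fin k ↣ Fin n → Elt → Elt
  projF {k} {n} f (m , a) with m ≟ n
  ... | yes refl = (k , a ↾ f)
  ... | no _     = (m , a)

  funB : ∀ {k} → Func♭ L k → (Fin k → Elt) → Elt
  funB (P k n f) xs = projF f (xs zero)

  relB : ∀ {k} → Rel♭ L k → (Fin k → Elt) → Set
  relB (U n)    xs = InU n (xs zero)
  relB (α♭ n α) xs = HoldsQF α (xs zero)

  𝔹 : QStructure (L♭ L)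
  𝔹 = record
    { struct = record { Carrier = Elt ; funᴹ = funB ; relᴹ = relB }
    ; _≈_ = _≈♭_ }

-- The translation φ ↦ φ^♭.
-- flat φ v is φ^♭ with its free variable z renamed to the variable v;
-- φ^♭(z) itself is flat φ zero (a formula in the single variable z).

private
  fin3 : ∀ {a} {A : Set a} → A → A → A → Fin 3 → A
  fin3 x y z zero             = x
  fin3 x y z (suc zero)       = y
  fin3 x y z (suc (suc zero)) = z

flat : {L : Language} → ∀ {n m} → Formula L n → Fin m → Formula (L♭ L) m
flat {n = n} (qf α) v = qf (atom (rel (α♭ n α) (λ _ → var v)))
flat (⋀ I φ) v = ⋀ I (λ i → flat (φ i) v)
flat (¬' φ)  v = ¬' (flat φ v)
flat {n = n} {m = m} (∃' θ) v =
  ∃' (⋀ (Fin 3) (fin3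
        (qf (atom (rel (U (suc n)) (λ _ → var w))))
        (flat θ w)
        (qf (atom (eq (app (P n (suc n) idInj) (λ _ → var w))
                      (var (inject₁ v)))))))
  where
    w : Fin (suc m)
    w = fromℕ m
    idInj : Fin n ↣ Fin (suc n)
    idInj = record { to = inject₁ ; cong = λ { refl → refl }
                   ; injective = inj₁-injective }
      where
        open import Data.Fin.Properties using (inject₁-injective)
        inj₁-injective : Injective _≡_ _≡_ (inject₁ {n})
        inj₁-injective = inject₁-injective

_♭ : {L : Language} → ∀ {n} → Formula L n → Formula (L♭ L) 1
φ ♭ = flat φ zero

-- Induction on φ, with the free variable z of φ^♭ allowed to sit at any
-- position of the assignment.
-- For ∃y θ: a witness w ∈ U_{n+1} of θ^♭ with P^{id}(w) = ā/E_n is a class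
-- b̄c/E_{n+1} with b̄ E_n ā; the forth property gives d with b̄c F ād, and
-- truth of L_{∞,ω}-formulas is invariant along a back-and-forth system,
-- so M ⊨ θ(ā, d). Conversely ā c/E_{n+1} is such a witness by reflexivity.

module Submission where

open import Defs
open import Data.Nat using (ℕ; zero; suc; _≟_)
open import Data.Fin using (Fin; zero; suc; fromℕ; inject₁)
open import Data.Vec using (Vec; []; _∷_; lookup; tabulate; _∷ʳ_; initLast)
open import Data.Vec.Properties using (tabulate∘lookup; tabulate-cong)
open import Data.Product using (∃; _,_)
open import Data.Product.Function.NonDependent.Propositional using (_×-⇔_)
open import Data.Empty using (⊥-elim)
open import Function.Bundles using (_⇔_; mk⇔; Equivalence; Injection; _↣_)
open import Function.Related.TypeIsomorphisms using (¬-cong-⇔)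
open import Relation.Binary.Definitions using (Reflexive)
open import Relation.Binary.PropositionalEquality
  using (_≡_; _≗_; refl; sym; trans; cong; subst; subst₂; module ≡-Reasoning)
open import Relation.Binary.Structures using (IsEquivalence)
open import Relation.Nullary using (yes; no)

open Equivalence using (to; from)

Π-cong-⇔ : ∀ {I : Set} {A B : I → Set} →
           (∀ i → A i ⇔ B i) → (∀ i → A i) ⇔ (∀ i → B i)
Π-cong-⇔ A⇔B = mk⇔ (λ f i → to (A⇔B i) (f i)) (λ g i → from (A⇔B i) (g i))

lookup-∷ʳ-fromℕ : ∀ {A : Set} {m} (ρ : Vec A m) x → lookup (ρ ∷ʳ x) (fromℕ m) ≡ x
lookup-∷ʳ-fromℕ []      x = refl
lookup-∷ʳ-fromℕ (_ ∷ ρ) x = lookup-∷ʳ-fromℕ ρ x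

lookup-∷ʳ-inject₁ : ∀ {A : Set} {m} (ρ : Vec A m) x i →
                    lookup (ρ ∷ʳ x) (inject₁ i) ≡ lookup ρ i
lookup-∷ʳ-inject₁ (_ ∷ ρ) x zero    = refl
lookup-∷ʳ-inject₁ (_ ∷ ρ) x (suc i) = lookup-∷ʳ-inject₁ ρ x i

↾-∷ʳ : ∀ {A : Set} {n} (f : Fin n ↣ Fin (suc n)) → Injection.to f ≗ inject₁ →
       (a : Vec A n) (x : A) → (a ∷ʳ x) ↾ f ≡ a
↾-∷ʳ f f≗inject₁ a x = begin
  tabulate (λ i → lookup (a ∷ʳ x) (Injection.to f i))
    ≡⟨ tabulate-cong (λ i → trans (cong (lookup (a ∷ʳ x)) (f≗inject₁ i))
                                  (lookup-∷ʳ-inject₁ a x i)) ⟩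
  tabulate (lookup a)
    ≡⟨ tabulate∘lookup a ⟩
  a ∎
  where open ≡-Reasoning

module _ {L : Language} {M : Structure L} {F : System (Structure.Carrier M)}
         (bf : IsBackAndForth M F) where
  open IsBackAndForth bf

  SatQF-preserved : ∀ {n a b} → F n a b → (α : QF L n) →
                    SatQF (std M) α a ⇔ SatQF (std M) α b
  SatQF-preserved p (atom α)  = preserves _ _ _ p α
  SatQF-preserved p (neg α)   = ¬-cong-⇔ (SatQF-preserved p α)
  SatQF-preserved p (and α β) = SatQF-preserved p α ×-⇔ SatQF-preserved p β

  Sat-preserved : ∀ {n a b} → F n a b → (φ : Formula L n) →
                  Sat (std M) φ a ⇔ Sat (std M) φ b
  Sat-preserved p (qf α)  = SatQF-preserved p α
  Sat-preserved p (⋀ I φ) = Π-cong-⇔ (λ i → Sat-preserved p (φ i))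
  Sat-preserved p (¬' φ)  = ¬-cong-⇔ (Sat-preserved p φ)
  Sat-preserved {n} {a} {b} p (∃' θ) = mk⇔
    (λ (c , s) → let (d , q) = forth n a b p c in d , to (Sat-preserved q θ) s)
    (λ (d , s) → let (c , q) = back n a b p d in c , from (Sat-preserved q θ) s)

module _ {L : Language} {M : Structure L} {F : System (Structure.Carrier M)}
         (bf : IsBackAndForth M F) (F-refl : ∀ n → Reflexive (F n)) where
  open Structure M renaming (Carrier to |M|)
  open IsBackAndForth bf using (forth)
  open Flat M F

  projF-U : ∀ {k n} (f : Fin k ↣ Fin n) (a : Vec |M| n) → projF f (n , a) ≡ (k , a ↾ f)
  projF-U {n = n} f a with n ≟ n
  ... | yes refl = refl
  ... | no n≢n   = ⊥-elim (n≢n refl)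

  projF-∷ʳ : ∀ {n} (f : Fin n ↣ Fin (suc n)) → Injection.to f ≗ inject₁ →
             (a : Vec |M| n) (c : |M|) → projF f (suc n , a ∷ʳ c) ≡ (n , a)
  projF-∷ʳ f f≗inject₁ a c =
    trans (projF-U f (a ∷ʳ c)) (cong (_ ,_) (↾-∷ʳ f f≗inject₁ a c))

  InU⇒ : ∀ {k e} → InU k e → ∃ λ (b : Vec |M| k) → e ≡ (k , b)
  InU⇒ (inU {a}) = a , refl

  ≈♭⇒F : ∀ {n a b} → (n , a) ≈♭ (n , b) → F n a b
  ≈♭⇒F (cls p) = p

  SatQF⇔HoldsQF : ∀ {n} (α : QF L n) {a} → SatQF (std M) α a ⇔ HoldsQF α (n , a)
  SatQF⇔HoldsQF α = mk⇔ holds (λ { (holds s) → s })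

  Sat-flat : ∀ {n m} (φ : Formula L n) (ρ : Vec Elt m) (v : Fin m) {a : Vec |M| n} →
             lookup ρ v ≡ (n , a) → Sat (std M) φ a ⇔ Sat 𝔹 (flat φ v) ρ
  Sat-flat (qf α) ρ v {a} ρv≡a =
    subst (λ e → SatQF (std M) α a ⇔ HoldsQF α e) (sym ρv≡a) (SatQF⇔HoldsQF α)
  Sat-flat (⋀ I φ) ρ v ρv≡a = Π-cong-⇔ (λ i → Sat-flat (φ i) ρ v ρv≡a)
  Sat-flat (¬' φ)  ρ v ρv≡a = ¬-cong-⇔ (Sat-flat φ ρ v ρv≡a)
  Sat-flat {n} {m} (∃' θ) ρ v {a} ρv≡a = mk⇔ intro elim
    where
    lookup-w : ∀ e → lookup (ρ ∷ʳ e) (fromℕ m) ≡ e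
    lookup-w = lookup-∷ʳ-fromℕ ρ

    lookup-z : ∀ e → lookup (ρ ∷ʳ e) (inject₁ v) ≡ (n , a)
    lookup-z e = trans (lookup-∷ʳ-inject₁ ρ e v) ρv≡a

    intro : Sat (std M) (∃' θ) a → Sat 𝔹 (flat (∃' θ) v) ρ
    intro (c , s) = (suc n , a ∷ʳ c) , λ where
      zero             → subst (InU (suc n)) (sym (lookup-w _)) inU
      (suc zero)       → to (Sat-flat θ (ρ ∷ʳ _) (fromℕ m) (lookup-w _)) s
      (suc (suc zero)) →
        subst₂ _≈♭_ (sym (trans (cong (projF _) (lookup-w _)) (projF-∷ʳ _ (λ _ → refl) a c)))
                    (sym (lookup-z _))
                    (cls (F-refl n))

    elim : Sat 𝔹 (flat (∃' θ) v) ρ → Sat (std M) (∃' θ) a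
    elim (e , h) with InU⇒ (subst (InU (suc n)) (lookup-w e) (h zero))
    ... | b , refl with initLast b
    ... | b′ , c , refl =
      let (d , b′c~ad) = forth n b′ a b′~a c in d , to (Sat-preserved bf b′c~ad θ) sθ
      where
      sθ : Sat (std M) θ (b′ ∷ʳ c)
      sθ = from (Sat-flat θ (ρ ∷ʳ _) (fromℕ m) (lookup-w _)) (h (suc zero))

      b′~a : F n b′ a
      b′~a = ≈♭⇒F (subst₂ _≈♭_
        (trans (cong (projF _) (lookup-w _)) (projF-∷ʳ _ (λ _ → refl) b′ c))
        (lookup-z _)
        (h (suc (suc zero))))

lemma2p7 : (L : Language) → IsCountableLanguage L →
    (M : Structure L) → (F : System (Structure.Carrier M)) → IsSharp M F →
    (n : ℕ) (φ : Formula L n) (a : Vec (Structure.Carrier M) n) →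
    Sat (std M) φ a ⇔ Sat (Flat.𝔹 M F) (φ ♭) ((n , a) ∷ [])
lemma2p7 L _ M F sharp n φ a =
  Sat-flat isBackAndForth (λ k → IsEquivalence.refl (isEquivalence k))
           φ ((n , a) ∷ []) zero refl
  where open IsSharp sharp
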